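{- If $G$ is a graph, then $\mathrm{czf}(G)\ge \alpha(G)$, where $\alpha(G)$ is the independence number of $G$.
   Context: All graphs are finite and simple. Constrained zero forcing: start with a set $S\subseteq V(G)$ of colored vertices, all others uncolored. A colored vertex $c$ may force an uncolored vertex $u$ to become colored if $u$ is the only uncolored neighbor of $c$; only vertices of the initial set $S$ may ever force. $S$ is a constrained zero forcing set if some sequence of forces colors all vertices. $\mathrm{czf}(G)$ is the minimum size of a constrained zero forcing set. $\alpha(G)$ is the maximum size of a set of pairwise non-adjacent vertices of $G$. -}

module Defs where

open import Data.Nat using (ℕ; _≤_)
open import Data.Bool using (Bool; T)
open import Data.Fin using (Fin)
open import Data.Fin.Subset using (Subset; _∈_; _∉_; _∪_; ⁅_⁆; ⊤; ∣_∣)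
open import Data.Product using (Σ; _×_; ∃₂)
open import Relation.Nullary using (¬_)
open import Relation.Binary.PropositionalEquality using (_≡_; _≢_)
open import Relation.Binary.Construct.Closure.ReflexiveTransitive using (Star)

record Graph (n : ℕ) : Set where
  field
    adj    : Fin n → Fin n → Bool
    sym    : ∀ u v → adj u v ≡ adj v u
    irrefl : ∀ v → adj v v ≡ Data.Bool.false

open Graph public

Adj : ∀ {n} → Graph n → Fin n → Fin n → Set
Adj G u v = T (adj G u v)

-- One constrained force: given the initial set S, the current coloured set C
-- becomes C ∪ {u}, where some c ∈ S (coloured) has u as its only uncoloured neighbour.
Force : ∀ {n} → Graph n → Subset n → Subset n → Subset n → Set
Force G S C C' =
  ∃₂ λ c u → c ∈ S × c ∈ C × u ∉ C × Adj G c u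
           × (∀ w → Adj G c w → w ≢ u → w ∈ C)
           × C' ≡ C ∪ ⁅ u ⁆

IsCZFSet : ∀ {n} → Graph n → Subset n → Set
IsCZFSet G S = Star (Force G S) S ⊤

IsIndependent : ∀ {n} → Graph n → Subset n → Set
IsIndependent G I = ∀ u v → u ∈ I → v ∈ I → ¬ Adj G u v

{-# OPTIONS --safe #-}
module Submission where

-- If c ∈ S forces u ∈ I, then u ∉ S, c ∉ I (c is adjacent to u), and afterwards every
-- neighbour of c is coloured, so c never forces again.  Forcing therefore injects
-- I ∖ S into S ∖ I.  The injection is tracked by the invariant that the coloured part
-- of I ∖ S is no larger than the set of vertices of S ∖ I whose neighbourhood is
-- already fully coloured.

open import Defs hiding (sym)
open import Data.Nat using (ℕ; _≤_; suc; _+_; z≤n; s≤s)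
open import Data.Nat.Properties using (≤-trans; +-suc; +-comm; +-mono-≤; +-monoʳ-≤; n≤1+n; module ≤-Reasoning)
open import Data.Bool.Properties using (T?)
open import Data.Fin using (Fin; _≟_)
open import Data.Fin.Properties using (all?)
open import Data.Fin.Subset using (Subset; inside; outside; _∈_; _∉_; _⊆_; _⊂_; _∩_; _∪_; ∁; ⁅_⁆; ⊤; ∣_∣)
open import Data.Fin.Subset.Properties
  using (_∈?_; x∈p∩q⁺; x∈p∩q⁻; x∈p∪q⁻; x∈⁅x⁆; x∈⁅y⁆⇒x≡y; x∈∁p⇒x∉p; x∉p⇒x∈∁p;
         p⊆p∪q; q⊆p∪q; p⊆q⇒∣p∣≤∣q∣; p⊂q⇒∣p∣<∣q∣; ∣p∩q∣≤∣p∣; ∣⁅x⁆∣≡1; ∩-comm; ∩-identityʳ)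
open import Data.Vec using ([]; _∷_; tabulate)
open import Data.Vec.Properties using (lookup∘tabulate; []=⇒lookup; lookup⇒[]=)
open import Data.Product using (_,_; proj₁; proj₂)
open import Data.Sum as Sum using (_⊎_; inj₁; inj₂)
open import Function using (_∘_; id)
open import Relation.Nullary using (yes; no; does; contradiction)
open import Relation.Nullary.Decidable using (_→-dec_; dec-true)
open import Relation.Unary using (Pred; Decidable)
open import Relation.Binary.PropositionalEquality using (_≡_; refl; sym; trans; cong; subst)
open import Relation.Binary.Construct.Closure.ReflexiveTransitive using (Star; fold)

private
  variable
    n : ℕ

toSubset : ∀ {p} {P : Pred (Fin n) p} → Decidable P → Subset n
toSubset P? = tabulate (does ∘ P?)

module _ {p} {P : Pred (Fin n) p} (P? : Decidable P) where

  x∈toSubset⁺ : ∀ {x} → P x → x ∈ toSubset P?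
  x∈toSubset⁺ {x} px =
    lookup⇒[]= x _ (trans (lookup∘tabulate _ x) (dec-true (P? x) px))

  x∈toSubset⁻ : ∀ {x} → x ∈ toSubset P? → P x
  x∈toSubset⁻ {x} x∈ with P? x | trans (sym (lookup∘tabulate _ x)) ([]=⇒lookup x∈)
  ... | yes px | _  = px
  ... | no _   | ()

∣p∪q∣≤∣p∣+∣q∣ : ∀ (p q : Subset n) → ∣ p ∪ q ∣ ≤ ∣ p ∣ + ∣ q ∣
∣p∪q∣≤∣p∣+∣q∣ []            []            = z≤n
∣p∪q∣≤∣p∣+∣q∣ (outside ∷ p) (outside ∷ q) = ∣p∪q∣≤∣p∣+∣q∣ p q
∣p∪q∣≤∣p∣+∣q∣ (outside ∷ p) (inside  ∷ q) =
  subst (suc ∣ p ∪ q ∣ ≤_) (sym (+-suc ∣ p ∣ ∣ q ∣)) (s≤s (∣p∪q∣≤∣p∣+∣q∣ p q))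
∣p∪q∣≤∣p∣+∣q∣ (inside  ∷ p) (outside ∷ q) = s≤s (∣p∪q∣≤∣p∣+∣q∣ p q)
∣p∪q∣≤∣p∣+∣q∣ (inside  ∷ p) (inside  ∷ q) =
  s≤s (≤-trans (∣p∪q∣≤∣p∣+∣q∣ p q) (+-monoʳ-≤ ∣ p ∣ (n≤1+n ∣ q ∣)))

∣p∪⁅x⁆∣≤1+∣p∣ : ∀ (p : Subset n) x → ∣ p ∪ ⁅ x ⁆ ∣ ≤ suc ∣ p ∣
∣p∪⁅x⁆∣≤1+∣p∣ p x = begin
  ∣ p ∪ ⁅ x ⁆ ∣     ≤⟨ ∣p∪q∣≤∣p∣+∣q∣ p ⁅ x ⁆ ⟩
  ∣ p ∣ + ∣ ⁅ x ⁆ ∣ ≡⟨ cong (∣ p ∣ +_) (∣⁅x⁆∣≡1 x) ⟩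
  ∣ p ∣ + 1         ≡⟨ +-comm ∣ p ∣ 1 ⟩
  suc ∣ p ∣         ∎
  where open ≤-Reasoning

∣p∣≡∣p∩q∣+∣p∩∁q∣ : ∀ (p q : Subset n) → ∣ p ∣ ≡ ∣ p ∩ q ∣ + ∣ p ∩ ∁ q ∣
∣p∣≡∣p∩q∣+∣p∩∁q∣ []            []            = refl
∣p∣≡∣p∩q∣+∣p∩∁q∣ (outside ∷ p) (_       ∷ q) = ∣p∣≡∣p∩q∣+∣p∩∁q∣ p q
∣p∣≡∣p∩q∣+∣p∩∁q∣ (inside  ∷ p) (inside  ∷ q) = cong suc (∣p∣≡∣p∩q∣+∣p∩∁q∣ p q)
∣p∣≡∣p∩q∣+∣p∩∁q∣ (inside  ∷ p) (outside ∷ q) =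
  trans (cong suc (∣p∣≡∣p∩q∣+∣p∩∁q∣ p q)) (sym (+-suc ∣ p ∩ q ∣ ∣ p ∩ ∁ q ∣))

∣p∩∁q∣≤∣q∩∁p∣⇒∣p∣≤∣q∣ : ∀ (p q : Subset n) → ∣ p ∩ ∁ q ∣ ≤ ∣ q ∩ ∁ p ∣ → ∣ p ∣ ≤ ∣ q ∣
∣p∩∁q∣≤∣q∩∁p∣⇒∣p∣≤∣q∣ p q le = begin
  ∣ p ∣                     ≡⟨ ∣p∣≡∣p∩q∣+∣p∩∁q∣ p q ⟩
  ∣ p ∩ q ∣ + ∣ p ∩ ∁ q ∣   ≤⟨ +-mono-≤ (p⊆q⇒∣p∣≤∣q∣ p∩q⊆q∩p) le ⟩
  ∣ q ∩ p ∣ + ∣ q ∩ ∁ p ∣   ≡⟨ sym (∣p∣≡∣p∩q∣+∣p∩∁q∣ q p) ⟩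
  ∣ q ∣                     ∎
  where
  open ≤-Reasoning
  p∩q⊆q∩p : p ∩ q ⊆ q ∩ p
  p∩q⊆q∩p x∈ = subst (_ ∈_) (∩-comm p q) x∈

x∈p∪⁅y⁆⁻ : ∀ (p : Subset n) y {x} → x ∈ p ∪ ⁅ y ⁆ → x ∈ p ⊎ x ≡ y
x∈p∪⁅y⁆⁻ p y x∈ = Sum.map₂ (x∈⁅y⁆⇒x≡y y) (x∈p∪q⁻ p ⁅ y ⁆ x∈)

p∩[q∪⁅y⁆]⊆p∩q∪⁅y⁆ : ∀ (p q : Subset n) y → p ∩ (q ∪ ⁅ y ⁆) ⊆ p ∩ q ∪ ⁅ y ⁆
p∩[q∪⁅y⁆]⊆p∩q∪⁅y⁆ p q y x∈ with x∈p∩q⁻ p _ x∈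
... | x∈p , x∈q∪y with x∈p∪⁅y⁆⁻ q y x∈q∪y
...   | inj₁ x∈q = p⊆p∪q ⁅ y ⁆ (x∈p∩q⁺ (x∈p , x∈q))
...   | inj₂ refl = q⊆p∪q (p ∩ q) ⁅ y ⁆ (x∈⁅x⁆ y)

y∉p⇒p∩[q∪⁅y⁆]⊆p∩q : ∀ (p q : Subset n) {y} → y ∉ p → p ∩ (q ∪ ⁅ y ⁆) ⊆ p ∩ q
y∉p⇒p∩[q∪⁅y⁆]⊆p∩q p q {y} y∉p x∈ with x∈p∩q⁻ p _ x∈
... | x∈p , x∈q∪y with x∈p∪⁅y⁆⁻ q y x∈q∪y
...   | inj₁ x∈q = x∈p∩q⁺ (x∈p , x∈q)
...   | inj₂ refl = contradiction x∈p y∉p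

module _ (G : Graph n) where

  NeighboursIn : Subset n → Pred (Fin n) _
  NeighboursIn C v = ∀ w → Adj G v w → w ∈ C

  neighboursIn? : ∀ C → Decidable (NeighboursIn C)
  neighboursIn? C v = all? (λ w → T? (adj G v w) →-dec (w ∈? C))

  Saturated : Subset n → Subset n
  Saturated C = toSubset (neighboursIn? C)

  saturated⁺ : ∀ {C v} → NeighboursIn C v → v ∈ Saturated C
  saturated⁺ {C} = x∈toSubset⁺ (neighboursIn? C)

  saturated⁻ : ∀ {C v} → v ∈ Saturated C → NeighboursIn C v
  saturated⁻ {C} = x∈toSubset⁻ (neighboursIn? C)

  Saturated-mono : ∀ {C C'} → C ⊆ C' → Saturated C ⊆ Saturated C'
  Saturated-mono C⊆C' v∈ = saturated⁺ (λ w v~w → C⊆C' (saturated⁻ v∈ w v~w))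

module _ (G : Graph n) (S I : Subset n) (indep : IsIndependent G I) where

  forced : Subset n → Subset n
  forced C = (I ∩ ∁ S) ∩ C

  spent : Subset n → Subset n
  spent C = (S ∩ ∁ I) ∩ Saturated G C

  Invariant : Subset n → Set
  Invariant C = ∣ forced C ∣ ≤ ∣ spent C ∣

  invariant-start : Invariant S
  invariant-start = p⊆q⇒∣p∣≤∣q∣ forced-S⊆spent-S
    where
    forced-S⊆spent-S : forced S ⊆ spent S
    forced-S⊆spent-S x∈ with x∈p∩q⁻ (I ∩ ∁ S) S x∈
    ... | x∈I∖S , x∈S = contradiction x∈S (x∈∁p⇒x∉p (proj₂ (x∈p∩q⁻ I _ x∈I∖S)))

  spent-mono : ∀ {C C'} → C ⊆ C' → spent C ⊆ spent C'
  spent-mono C⊆C' x∈ with x∈p∩q⁻ (S ∩ ∁ I) _ x∈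
  ... | x∈S∖I , x∈sat = x∈p∩q⁺ (x∈S∖I , Saturated-mono G C⊆C' x∈sat)

  force-preserves-invariant : ∀ {C C'} → Force G S C C' → Invariant C → Invariant C'
  force-preserves-invariant {C} (c , u , c∈S , _ , u∉C , c~u , rest∈C , refl) inv with u ∈? I
  ... | no u∉I = begin
    ∣ forced (C ∪ ⁅ u ⁆) ∣ ≤⟨ p⊆q⇒∣p∣≤∣q∣ (y∉p⇒p∩[q∪⁅y⁆]⊆p∩q (I ∩ ∁ S) C (u∉I ∘ proj₁ ∘ x∈p∩q⁻ I _)) ⟩
    ∣ forced C ∣           ≤⟨ inv ⟩
    ∣ spent C ∣            ≤⟨ p⊆q⇒∣p∣≤∣q∣ (spent-mono (p⊆p∪q ⁅ u ⁆)) ⟩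
    ∣ spent (C ∪ ⁅ u ⁆) ∣  ∎
    where open ≤-Reasoning
  ... | yes u∈I = begin
    ∣ forced (C ∪ ⁅ u ⁆) ∣ ≤⟨ p⊆q⇒∣p∣≤∣q∣ (p∩[q∪⁅y⁆]⊆p∩q∪⁅y⁆ (I ∩ ∁ S) C u) ⟩
    ∣ forced C ∪ ⁅ u ⁆ ∣   ≤⟨ ∣p∪⁅x⁆∣≤1+∣p∣ (forced C) u ⟩
    suc ∣ forced C ∣       ≤⟨ s≤s inv ⟩
    suc ∣ spent C ∣        ≤⟨ p⊂q⇒∣p∣<∣q∣ (spent-mono (p⊆p∪q ⁅ u ⁆) , c , c∈spent , c∉spent) ⟩
    ∣ spent (C ∪ ⁅ u ⁆) ∣  ∎
    where
    open ≤-Reasoning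
    c∉I : c ∉ I
    c∉I c∈I = indep c u c∈I u∈I c~u
    c-saturated : NeighboursIn G (C ∪ ⁅ u ⁆) c
    c-saturated w c~w with w ≟ u
    ... | yes refl = q⊆p∪q C ⁅ u ⁆ (x∈⁅x⁆ u)
    ... | no w≢u   = p⊆p∪q ⁅ u ⁆ (rest∈C w c~w w≢u)
    c∈spent : c ∈ spent (C ∪ ⁅ u ⁆)
    c∈spent = x∈p∩q⁺ (x∈p∩q⁺ (c∈S , x∉p⇒x∈∁p c∉I) , saturated⁺ G c-saturated)
    c∉spent : c ∉ spent C
    c∉spent c∈ = u∉C (saturated⁻ G (proj₂ (x∈p∩q⁻ _ _ c∈)) u c~u)

  forcing-preserves-invariant : ∀ {C C'} → Star (Force G S) C C' → Invariant C → Invariant C'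
  forcing-preserves-invariant =
    fold (λ C C' → Invariant C → Invariant C') (λ force rest → rest ∘ force-preserves-invariant force) id

  ∣I∩∁S∣≤∣S∩∁I∣ : IsCZFSet G S → ∣ I ∩ ∁ S ∣ ≤ ∣ S ∩ ∁ I ∣
  ∣I∩∁S∣≤∣S∩∁I∣ czf = begin
    ∣ I ∩ ∁ S ∣  ≡⟨ cong ∣_∣ (sym (∩-identityʳ (I ∩ ∁ S))) ⟩
    ∣ forced ⊤ ∣ ≤⟨ forcing-preserves-invariant czf invariant-start ⟩
    ∣ spent ⊤ ∣  ≤⟨ ∣p∩q∣≤∣p∣ (S ∩ ∁ I) (Saturated G ⊤) ⟩
    ∣ S ∩ ∁ I ∣  ∎
    where open ≤-Reasoning

mainTheorem8 : ∀ {n} (G : Graph n) (S I : Subset n) →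
    IsCZFSet G S → IsIndependent G I → ∣ I ∣ ≤ ∣ S ∣
mainTheorem8 G S I czf indep = ∣p∩∁q∣≤∣q∩∁p∣⇒∣p∣≤∣q∣ I S (∣I∩∁S∣≤∣S∩∁I∣ G S I indep czf)
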